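{- For every integer $k\geq 2$ there is a sequence $(b_n)_{n\ge 0}$ of nonnegative integers such that $$f_{0,k}(q)=1-q+q^2+\sum_{n=0}^\infty b_nq^n.$$
   Context: For $k\ge 0$, with $(a;q)_k=\prod_{i=0}^{k-1}(1-aq^i)$, the formal power series $f_{m,k}(q)$ ($m\in\mathbb{Z}$) are defined as the coefficients in the expansion $$\sum_{m=-\infty}^{\infty} z^m f_{m,k}(q)=\frac{1-q}{(zq;q)_k(q/z;q)_k},$$ where $\frac{1}{1-zq^i}$ and $\frac{1}{1-q^i/z}$ are expanded as geometric series in $q$. -}

module Defs where

open import Data.Nat as ℕ using (ℕ; zero; suc; _≤ᵇ_)
open import Data.Integer as ℤ using (ℤ; +_; -[1+_]; _+_; _-_)
open import Data.Bool using (if_then_else_)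

sumTo : ℕ → (ℕ → ℤ) → ℤ
sumTo zero    f = f zero
sumTo (suc n) f = sumTo n f + f (suc n)

isZeroℤ : ℤ → Data.Bool.Bool
isZeroℤ (+ zero)  = Data.Bool.true
isZeroℤ _         = Data.Bool.false

isZeroℕ : ℕ → Data.Bool.Bool
isZeroℕ zero = Data.Bool.true
isZeroℕ _    = Data.Bool.false

-- G j m n = coefficient of z^m q^n in
--   ∏_{i=1}^{j} 1 / ((1 - z q^i)(1 - q^i / z)),
-- each factor expanded as a geometric series in q:
--   1/((1 - z q^i)(1 - q^i/z)) = Σ_{a,b ≥ 0} z^(a-b) q^(i(a+b)).
G : ℕ → ℤ → ℕ → ℤ
G zero m n = if isZeroℤ m then (if isZeroℕ n then + 1 else + 0) else + 0
G (suc j) m n =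
  sumTo n λ a → sumTo n λ b →
    if (suc j ℕ.* (a ℕ.+ b)) ≤ᵇ n
      then G j (m - + a + + b) (n ℕ.∸ (suc j ℕ.* (a ℕ.+ b)))
      else + 0

-- fCoeff m k n = coefficient of q^n in f_{m,k}(q),
-- where Σ_m z^m f_{m,k}(q) = (1 - q) / ((zq;q)_k (q/z;q)_k).
fCoeff : ℤ → ℕ → ℕ → ℤ
fCoeff m k zero    = G k m zero
fCoeff m k (suc n) = G k m (suc n) - G k m n

onePoly : ℕ → ℤ
onePoly 0 = + 1
onePoly 1 = -[1+ 0 ]
onePoly 2 = + 1
onePoly _ = + 0

-- Let f_k = (1 - q) G_k with G_k = ∏_{i ≤ k} 1/((1 - z qⁱ)(1 - qⁱ/z)), so that f_{m,k} is the
-- zᵐ-part of f_k, and let P_k = 1 - q + q² + (z + z⁻¹) q^(k+2). We show P_k ≤ f_k coefficientwise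
-- for k ≥ 2; the z⁰-part is the claim. Dividing by D = (1 - z qⁱ)(1 - qⁱ/z), i = k + 1, preserves
-- coefficientwise inequalities, so f_{k+1} ≥ P_k F with F = 1/D. From F = 1 + (z + z⁻¹) qⁱ F - q²ⁱ F
-- and F ≥ 0 one reads off F ≥ 1, F ≥ 1 + (z + z⁻¹) qⁱ and qF ≤ q + (z + z⁻¹) q^(i+1) F, which give
-- P_k F ≥ P_{k+1}. Quotients by D are identified through this recurrence, which determines them.
-- For k = 2 we check closed forms against the recurrence: the z^(±M)-part of f_1 is q^M/(1 + q), and
-- that of f_2 is a polynomial over (1 - q³)(1 - q⁴), whose nonnegativity reduces to
-- monotonicity and one period of the quasi-polynomial counting solutions of 3a + 4b = t.

module Submission where

open import Defs
open import Data.Nat using (ℕ; _≤_)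
open import Data.Integer using (ℤ; +_; _+_)
open import Data.Product using (Σ)
open import Relation.Binary.PropositionalEquality using (_≡_)

open import Data.Bool using (true; false; if_then_else_)
open import Data.Empty using (⊥-elim)
open import Data.Fin using (Fin; toℕ; fromℕ<)
open import Data.Fin.Properties using (all?; toℕ-fromℕ<)
open import Data.Integer as ℤ using (-[1+_]; _-_; -_; ∣_∣; +≤+)
import Data.Integer.Properties as ℤP
open import Data.Integer.Tactic.RingSolver using (solve-∀)
open import Data.Nat as ℕ using (zero; suc; _<_; _∸_; z≤n; s≤s; _≤ᵇ_; _≤?_; NonZero)
open import Data.Nat.Induction using (<-rec)
import Data.Nat.Properties as ℕP
import Data.Nat.Tactic.RingSolver as ℕ-Solver
open import Data.Product using (_,_)
open import Data.Unit using (tt)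
open import Relation.Binary.PropositionalEquality
  using (_≢_; refl; sym; trans; cong; cong₂; subst; subst₂; module ≡-Reasoning)
open import Relation.Nullary using (Dec; yes; no; ¬_)
open import Relation.Nullary.Decidable using (True; toWitness)

combine-≤ : ∀ {a a′ b b′ c c′ d d′} → a ℤ.≤ a′ → b′ ℤ.≤ b + d′ → c + d ℤ.≤ c′ →
            a - b + c + d ℤ.≤ a′ - b′ + c′ + d′
combine-≤ {a} {a′} {b} {b′} {c} {c′} {d} {d′} a≤a′ b′≤b+d′ c+d≤c′ = begin
  a - b + c + d                 ≡⟨ regroup a b c d d′ ⟩
  a + (c + d) + (d′ - (b + d′)) ≤⟨ ℤP.+-mono-≤ (ℤP.+-mono-≤ a≤a′ c+d≤c′)
                                                 (ℤP.+-monoʳ-≤ d′ (ℤP.neg-mono-≤ b′≤b+d′)) ⟩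
  a′ + c′ + (d′ - b′)           ≡⟨ regroup′ a′ b′ c′ d′ ⟩
  a′ - b′ + c′ + d′             ∎
  where
  open ℤP.≤-Reasoning
  regroup : ∀ a b c d e → a - b + c + d ≡ a + (c + d) + (e - (b + e))
  regroup = solve-∀
  regroup′ : ∀ a b c e → a + c + (e - b) ≡ a - b + c + e
  regroup′ = solve-∀

0≤x+y-z : ∀ {x y z} → z ℤ.≤ x → + 0 ℤ.≤ y → + 0 ℤ.≤ x + y - z
0≤x+y-z {x} {y} {z} z≤x 0≤y = subst (+ 0 ℤ.≤_) (regroup x y z) (ℤP.+-mono-≤ (ℤP.i≤j⇒0≤j-i z≤x) 0≤y)
  where
  regroup : ∀ x y z → x - z + y ≡ x + y - z
  regroup = solve-∀

0≤x+y-z′ : ∀ {x y z} → z ℤ.≤ y → + 0 ℤ.≤ x → + 0 ℤ.≤ x + y - z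
0≤x+y-z′ {x} {y} {z} z≤y 0≤x = subst (λ s → + 0 ℤ.≤ s - z) (ℤP.+-comm y x) (0≤x+y-z z≤y 0≤x)

≤⇒≡+∣-∣ : ∀ {x y} → x ℤ.≤ y → y ≡ x + + ∣ y - x ∣
≤⇒≡+∣-∣ {x} {y} x≤y = trans (split x y) (cong (_+_ x) (sym (ℤP.0≤i⇒+∣i∣≡i (ℤP.i≤j⇒0≤j-i x≤y))))
  where
  split : ∀ x y → y ≡ x + (y - x)
  split = solve-∀

periodicInduction : ∀ p .{{_ : NonZero p}} {P : ℕ → Set} →
                    (∀ (r : Fin p) → P (toℕ r)) → (∀ t → P t → P (p ℕ.+ t)) → ∀ t → P t
periodicInduction p {P} base step = <-rec P go
  where
  go : ∀ t → (∀ {s} → s < t → P s) → P t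
  go t earlier with t ℕP.<? p
  ... | yes t<p = subst P (toℕ-fromℕ< t<p) (base (fromℕ< t<p))
  ... | no t≮p  = subst P (ℕP.m+[n∸m]≡n p≤t) (step (t ∸ p) (earlier (ℕP.∸-monoʳ-< (ℕ.>-nonZero⁻¹ p) p≤t)))
    where
    p≤t = ℕP.≮⇒≥ t≮p

byComputation : ∀ {p} {P : ℕ → Set} (P? : ∀ t → Dec (P t)) →
                True (all? (λ (r : Fin p) → P? (toℕ r))) → ∀ (r : Fin p) → P (toℕ r)
byComputation P? = toWitness

guard : ℕ → ℕ → ℤ → ℤ
guard c n x = if c ≤ᵇ n then x else + 0

module _ (c n : ℕ) where

  guard-yes : ∀ x → c ≤ n → guard c n x ≡ x
  guard-yes x c≤n with c ≤ᵇ n | ℕP.≤⇒≤ᵇ c≤n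
  ... | true | _ = refl

  guard-no : ∀ x → ¬ c ≤ n → guard c n x ≡ + 0
  guard-no x c≰n with c ≤ᵇ n | (λ t → c≰n (ℕP.≤ᵇ⇒≤ c n t))
  ... | true  | c≰n′ = ⊥-elim (c≰n′ tt)
  ... | false | _    = refl

  guard-cong : ∀ {x y} → (c ≤ n → x ≡ y) → guard c n x ≡ guard c n y
  guard-cong {x} {y} x≡y with c ≤? n
  ... | yes c≤n = trans (guard-yes x c≤n) (trans (x≡y c≤n) (sym (guard-yes y c≤n)))
  ... | no c≰n  = trans (guard-no x c≰n) (sym (guard-no y c≰n))

  guard-0 : guard c n (+ 0) ≡ + 0
  guard-0 with c ≤ᵇ n
  ... | true  = refl
  ... | false = refl

  guard-+ : ∀ x y → guard c n (x + y) ≡ guard c n x + guard c n y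
  guard-+ x y with c ≤ᵇ n
  ... | true  = refl
  ... | false = refl

  guard-neg : ∀ x → guard c n (- x) ≡ - guard c n x
  guard-neg x with c ≤ᵇ n
  ... | true  = refl
  ... | false = refl

  guard-mono : ∀ {x y} → x ℤ.≤ y → guard c n x ℤ.≤ guard c n y
  guard-mono x≤y with c ≤ᵇ n
  ... | true  = x≤y
  ... | false = ℤP.≤-refl

  guard-nonneg : ∀ {x} → + 0 ℤ.≤ x → + 0 ℤ.≤ guard c n x
  guard-nonneg {x} 0≤x = subst (ℤ._≤ guard c n x) guard-0 (guard-mono 0≤x)

guard-minus : ∀ c n x y → guard c n (x - y) ≡ guard c n x - guard c n y
guard-minus c n x y = trans (guard-+ c n x (- y)) (cong (_+_ (guard c n x)) (guard-neg c n y))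

guard-suc : ∀ c n x → guard (suc c) (suc n) x ≡ guard c n x
guard-suc zero    n x = refl
guard-suc (suc c) n x = refl

guard-guard : ∀ c d n x → guard c n (guard d (n ∸ c) x) ≡ guard (c ℕ.+ d) n x
guard-guard zero    d n       x = refl
guard-guard (suc c) d zero    x = refl
guard-guard (suc c) d (suc n) x =
  trans (guard-suc c n _) (trans (guard-guard c d n x) (sym (guard-suc (c ℕ.+ d) n x)))

guard-comm : ∀ c d n (f : ℕ → ℤ) →
  guard c n (guard d (n ∸ c) (f (n ∸ c ∸ d))) ≡ guard d n (guard c (n ∸ d) (f (n ∸ d ∸ c)))
guard-comm c d n f = begin
  guard c n (guard d (n ∸ c) (f (n ∸ c ∸ d))) ≡⟨ guard-guard c d n _ ⟩
  guard (c ℕ.+ d) n (f (n ∸ c ∸ d))           ≡⟨ cong₂ (λ e k → guard e n (f k)) (ℕP.+-comm c d) (∸-comm c d) ⟩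
  guard (d ℕ.+ c) n (f (n ∸ d ∸ c))           ≡⟨ sym (guard-guard d c n _) ⟩
  guard d n (guard c (n ∸ d) (f (n ∸ d ∸ c))) ∎
  where
  open ≡-Reasoning
  ∸-comm : ∀ c d → n ∸ c ∸ d ≡ n ∸ d ∸ c
  ∸-comm c d = trans (ℕP.∸-+-assoc n c d) (trans (cong (n ∸_) (ℕP.+-comm c d)) (sym (ℕP.∸-+-assoc n d c)))

sumTo-cong : ∀ n {f g : ℕ → ℤ} → (∀ a → f a ≡ g a) → sumTo n f ≡ sumTo n g
sumTo-cong zero    f≡g = f≡g 0
sumTo-cong (suc n) f≡g = cong₂ _+_ (sumTo-cong n f≡g) (f≡g (suc n))

sumTo-0 : ∀ n {f : ℕ → ℤ} → (∀ a → f a ≡ + 0) → sumTo n f ≡ + 0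
sumTo-0 zero    f≡0 = f≡0 0
sumTo-0 (suc n) f≡0 rewrite sumTo-0 n f≡0 | f≡0 (suc n) = refl

sumTo-mono : ∀ n {f g : ℕ → ℤ} → (∀ a → f a ℤ.≤ g a) → sumTo n f ℤ.≤ sumTo n g
sumTo-mono zero    f≤g = f≤g 0
sumTo-mono (suc n) f≤g = ℤP.+-mono-≤ (sumTo-mono n f≤g) (f≤g (suc n))

sumTo-suc : ∀ n f → sumTo (suc n) f ≡ f 0 + sumTo n (λ a → f (suc a))
sumTo-suc zero    f = refl
sumTo-suc (suc n) f rewrite sumTo-suc n f = ℤP.+-assoc (f 0) _ _

sumTo-guard : ∀ N c n (f : ℕ → ℤ) → sumTo N (λ a → guard c n (f a)) ≡ guard c n (sumTo N f)
sumTo-guard zero    c n f = refl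
sumTo-guard (suc N) c n f =
  trans (cong (_+ guard c n (f (suc N))) (sumTo-guard N c n f)) (sym (guard-+ c n _ _))

sumTo-extend : ∀ {n N} (f : ℕ → ℤ) → n ≤ N → (∀ a → n < a → f a ≡ + 0) → sumTo N f ≡ sumTo n f
sumTo-extend {n} {zero}  f z≤n vanish = refl
sumTo-extend {n} {suc N} f n≤1+N vanish with n ℕ.≟ suc N
... | yes refl = refl
... | no n≢1+N with ℕP.≤∧≢⇒< n≤1+N n≢1+N
...   | n<1+N = trans (cong₂ _+_ (sumTo-extend {N = N} f (ℕP.<⇒≤pred n<1+N) vanish) (vanish (suc N) n<1+N))
                      (ℤP.+-identityʳ _)

sumTo-nonneg : ∀ n {f : ℕ → ℤ} → (∀ a → + 0 ℤ.≤ f a) → + 0 ℤ.≤ sumTo n f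
sumTo-nonneg n {f} 0≤f = subst (ℤ._≤ sumTo n f) (sumTo-0 n λ _ → refl) (sumTo-mono n 0≤f)

-- X m n is the coefficient of zᵐ qⁿ
Series : Set
Series = ℤ → ℕ → ℤ

infixl 6 _⊕_ _⊝_

_⊕_ _⊝_ : Series → Series → Series
(X ⊕ Y) m n = X m n + Y m n
(X ⊝ Y) m n = X m n - Y m n

negₛ : Series → Series
negₛ X m n = - X m n

-- multiplication by zᵉ, by qᵈ, and by z + z⁻¹
zShift : ℤ → Series → Series
zShift e X m n = X (m - e) n

qShift : ℕ → Series → Series
qShift d X m n = guard d n (X m (n ∸ d))

zz : Series → Series
zz X = zShift (+ 1) X ⊕ zShift -[1+ 0 ] X

infix 4 _≤ₛ_

_≤ₛ_ : Series → Series → Set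
X ≤ₛ Y = ∀ m n → X m n ℤ.≤ Y m n

NonNegₛ : Series → Set
NonNegₛ X = ∀ m n → + 0 ℤ.≤ X m n

qShift-mono : ∀ d {X Y} → X ≤ₛ Y → qShift d X ≤ₛ qShift d Y
qShift-mono d X≤Y m n = guard-mono d n (X≤Y m (n ∸ d))

qShift-⊕-qShift : ∀ c d X Y m n → qShift c (X ⊕ qShift d Y) m n ≡ qShift c X m n + qShift (c ℕ.+ d) Y m n
qShift-⊕-qShift c d X Y m n =
  trans (guard-+ c n _ _) (cong (_+_ (qShift c X m n))
    (trans (guard-guard c d n _) (cong (λ k → guard (c ℕ.+ d) n (Y m k)) (ℕP.∸-+-assoc n c d))))

term : ℕ → Series → ℤ → ℕ → ℕ → ℕ → ℤ
term i H m n a b = guard (i ℕ.* (a ℕ.+ b)) n (H (m - + a + + b) (n ∸ i ℕ.* (a ℕ.+ b)))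

-- H / ((1 - z qⁱ)(1 - qⁱ/z)), so that G (suc j) is definitionally divide (suc j) (G j)
divide : ℕ → Series → Series
divide i H m n = sumTo n λ a → sumTo n λ b → term i H m n a b

-- H / (1 - qⁱ/z); dividing it further by 1 - z qⁱ gives divide i H
divide⁻ : ℕ → Series → Series
divide⁻ i H m n = sumTo n (term i H m n 0)

module _ (i : ℕ) .{{_ : NonZero i}} (H : Series) where
  open ≡-Reasoning

  term-vanish : ∀ m n a b → n < a ℕ.+ b → term i H m n a b ≡ + 0
  term-vanish m n a b n<a+b =
    guard-no _ _ _ (ℕP.<⇒≱ (ℕP.<-≤-trans n<a+b (ℕP.m≤n*m (a ℕ.+ b) i)))

  divide-bounds : ∀ m n {A B} → n ≤ A → n ≤ B →
                  sumTo A (λ a → sumTo B (term i H m n a)) ≡ divide i H m n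
  divide-bounds m n {A} {B} n≤A n≤B = begin
    sumTo A (λ a → sumTo B (term i H m n a))
      ≡⟨ sumTo-cong A (λ a → sumTo-extend _ n≤B λ b n<b →
           term-vanish m n a b (ℕP.<-≤-trans n<b (ℕP.m≤n+m b a))) ⟩
    sumTo A (λ a → sumTo n (term i H m n a))
      ≡⟨ sumTo-extend _ n≤A (λ a n<a → sumTo-0 n λ b →
           term-vanish m n a b (ℕP.<-≤-trans n<a (ℕP.m≤m+n a b))) ⟩
    divide i H m n ∎

  divide⁻-bound : ∀ m n {B} → n ≤ B → sumTo B (term i H m n 0) ≡ divide⁻ i H m n
  divide⁻-bound m n n≤B = sumTo-extend _ n≤B (λ b n<b → term-vanish m n 0 b n<b)

  term-suc-left : ∀ m n a b → term i H m n (suc a) b ≡ guard i n (term i H (m - + 1) (n ∸ i) a b)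
  term-suc-left m n a b = begin
    guard (i ℕ.* suc (a ℕ.+ b)) n (H (m - + suc a + + b) (n ∸ i ℕ.* suc (a ℕ.+ b)))
      ≡⟨ cong (λ c → guard c n (H (m - + suc a + + b) (n ∸ c))) (ℕP.*-suc i (a ℕ.+ b)) ⟩
    guard (i ℕ.+ c) n (H (m - + suc a + + b) (n ∸ (i ℕ.+ c)))
      ≡⟨ cong₂ (λ k l → guard (i ℕ.+ c) n (H k l)) (reassoc m (+ a) (+ b)) (sym (ℕP.∸-+-assoc n i c)) ⟩
    guard (i ℕ.+ c) n (H (m - + 1 - + a + + b) (n ∸ i ∸ c))
      ≡⟨ sym (guard-guard i c n _) ⟩
    guard i n (term i H (m - + 1) (n ∸ i) a b) ∎
    where
    c = i ℕ.* (a ℕ.+ b)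
    reassoc : ∀ m a b → m - (+ 1 + a) + b ≡ m - + 1 - a + b
    reassoc = solve-∀

  term-suc-right : ∀ m n b → term i H m n 0 (suc b) ≡ guard i n (term i H (m + + 1) (n ∸ i) 0 b)
  term-suc-right m n b = begin
    guard (i ℕ.* suc b) n (H (m - + 0 + + suc b) (n ∸ i ℕ.* suc b))
      ≡⟨ cong (λ c → guard c n (H (m - + 0 + + suc b) (n ∸ c))) (ℕP.*-suc i b) ⟩
    guard (i ℕ.+ c) n (H (m - + 0 + + suc b) (n ∸ (i ℕ.+ c)))
      ≡⟨ cong₂ (λ k l → guard (i ℕ.+ c) n (H k l)) (reassoc m (+ b)) (sym (ℕP.∸-+-assoc n i c)) ⟩
    guard (i ℕ.+ c) n (H (m + + 1 - + 0 + + b) (n ∸ i ∸ c))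
      ≡⟨ sym (guard-guard i c n _) ⟩
    guard i n (term i H (m + + 1) (n ∸ i) 0 b) ∎
    where
    c = i ℕ.* b
    reassoc : ∀ m b → m - + 0 + (+ 1 + b) ≡ m + + 1 - + 0 + b
    reassoc = solve-∀

  term-zero : ∀ m n → term i H m n 0 0 ≡ H m n
  term-zero m n rewrite ℕP.*-zeroʳ i = cong (λ k → H k n) (m-0+0 m)
    where
    m-0+0 : ∀ m → m - + 0 + + 0 ≡ m
    m-0+0 = solve-∀

  divide-peel : ∀ m n → divide i H m n ≡ divide⁻ i H m n + guard i n (divide i H (m - + 1) (n ∸ i))
  divide-peel m n = begin
    divide i H m n
      ≡⟨ sym (divide-bounds m n (ℕP.n≤1+n n) ℕP.≤-refl) ⟩
    sumTo (suc n) (λ a → sumTo n (term i H m n a))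
      ≡⟨ sumTo-suc n _ ⟩
    divide⁻ i H m n + sumTo n (λ a → sumTo n (term i H m n (suc a)))
      ≡⟨ cong (_+_ (divide⁻ i H m n)) (sumTo-cong n λ a →
           trans (sumTo-cong n (term-suc-left m n a)) (sumTo-guard n i n _)) ⟩
    divide⁻ i H m n + sumTo n (λ a → guard i n (sumTo n (term i H (m - + 1) (n ∸ i) a)))
      ≡⟨ cong (_+_ (divide⁻ i H m n)) (trans (sumTo-guard n i n _)
           (cong (guard i n) (divide-bounds (m - + 1) (n ∸ i) (ℕP.m∸n≤m n i) (ℕP.m∸n≤m n i)))) ⟩
    divide⁻ i H m n + guard i n (divide i H (m - + 1) (n ∸ i)) ∎

  divide⁻-peel : ∀ m n → divide⁻ i H m n ≡ H m n + guard i n (divide⁻ i H (m + + 1) (n ∸ i))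
  divide⁻-peel m n = begin
    divide⁻ i H m n
      ≡⟨ sym (divide⁻-bound m n (ℕP.n≤1+n n)) ⟩
    sumTo (suc n) (term i H m n 0)
      ≡⟨ sumTo-suc n _ ⟩
    term i H m n 0 0 + sumTo n (λ b → term i H m n 0 (suc b))
      ≡⟨ cong₂ _+_ (term-zero m n) (trans (sumTo-cong n (term-suc-right m n)) (sumTo-guard n i n _)) ⟩
    H m n + guard i n (sumTo n (term i H (m + + 1) (n ∸ i) 0))
      ≡⟨ cong (λ s → H m n + guard i n s) (divide⁻-bound (m + + 1) (n ∸ i) (ℕP.m∸n≤m n i)) ⟩
    H m n + guard i n (divide⁻ i H (m + + 1) (n ∸ i)) ∎

  divide⁻-via-divide : ∀ m n → divide⁻ i H (m + + 1) n ≡ divide i H (m + + 1) n - guard i n (divide i H m (n ∸ i))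
  divide⁻-via-divide m n = begin
    divide⁻ i H (m + + 1) n
      ≡⟨ unpeel _ (guard i n (divide i H m (n ∸ i))) ⟩
    divide⁻ i H (m + + 1) n + guard i n (divide i H m (n ∸ i)) - guard i n (divide i H m (n ∸ i))
      ≡⟨ cong (λ k → divide⁻ i H (m + + 1) n + guard i n (divide i H k (n ∸ i)) - guard i n (divide i H m (n ∸ i)))
           (sym (m+1-1 m)) ⟩
    divide⁻ i H (m + + 1) n + guard i n (divide i H (m + + 1 - + 1) (n ∸ i)) - guard i n (divide i H m (n ∸ i))
      ≡⟨ cong (_- guard i n (divide i H m (n ∸ i))) (sym (divide-peel (m + + 1) n)) ⟩
    divide i H (m + + 1) n - guard i n (divide i H m (n ∸ i)) ∎
    where
    unpeel : ∀ x y → x ≡ x + y - y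
    unpeel = solve-∀
    m+1-1 : ∀ m → m + + 1 - + 1 ≡ m
    m+1-1 = solve-∀

divide-mono : ∀ i {H H′} → H ≤ₛ H′ → divide i H ≤ₛ divide i H′
divide-mono i H≤H′ m n =
  sumTo-mono n λ a → sumTo-mono n λ b → guard-mono (i ℕ.* (a ℕ.+ b)) n (H≤H′ _ _)

divide-nonneg : ∀ i {H} → NonNegₛ H → NonNegₛ (divide i H)
divide-nonneg i 0≤H m n =
  sumTo-nonneg n λ a → sumTo-nonneg n λ b → guard-nonneg (i ℕ.* (a ℕ.+ b)) n (0≤H _ _)

-- X (1 - z qⁱ)(1 - qⁱ/z) = H, that is X = H + (z + z⁻¹) qⁱ X - q²ⁱ X, read coefficientwise
record IsQuotient (i : ℕ) (H X : Series) : Set where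
  field
    recurrence : ∀ m n → X m n ≡ H m n + guard i n (X (m - + 1) (n ∸ i) + X (m + + 1) (n ∸ i))
                                       - guard (i ℕ.+ i) n (X m (n ∸ (i ℕ.+ i)))
open IsQuotient public

divide-isQuotient : ∀ i .{{_ : NonZero i}} H → IsQuotient i H (divide i H)
recurrence (divide-isQuotient i H) m n = begin
  X m n
    ≡⟨ divide-peel i H m n ⟩
  divide⁻ i H m n + guard i n (X (m - + 1) n′)
    ≡⟨ cong (_+ guard i n (X (m - + 1) n′)) (divide⁻-peel i H m n) ⟩
  H m n + guard i n (divide⁻ i H (m + + 1) n′) + guard i n (X (m - + 1) n′)
    ≡⟨ cong (λ s → H m n + guard i n s + guard i n (X (m - + 1) n′)) (divide⁻-via-divide i H m n′) ⟩
  H m n + guard i n (X (m + + 1) n′ - guard i n′ (X m (n′ ∸ i))) + guard i n (X (m - + 1) n′)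
    ≡⟨ cong (λ s → H m n + s + guard i n (X (m - + 1) n′)) (guard-minus i n _ _) ⟩
  H m n + (guard i n (X (m + + 1) n′) - guard i n (guard i n′ (X m (n′ ∸ i)))) + guard i n (X (m - + 1) n′)
    ≡⟨ cong (λ s → H m n + (guard i n (X (m + + 1) n′) - s) + guard i n (X (m - + 1) n′))
         (trans (guard-guard i i n _) (cong (λ k → guard (i ℕ.+ i) n (X m k)) (ℕP.∸-+-assoc n i i))) ⟩
  H m n + (guard i n (X (m + + 1) n′) - guard (i ℕ.+ i) n (X m (n ∸ (i ℕ.+ i)))) + guard i n (X (m - + 1) n′)
    ≡⟨ rearrange (H m n) _ _ _ ⟩
  H m n + (guard i n (X (m - + 1) n′) + guard i n (X (m + + 1) n′)) - guard (i ℕ.+ i) n (X m (n ∸ (i ℕ.+ i)))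
    ≡⟨ cong (λ s → H m n + s - guard (i ℕ.+ i) n (X m (n ∸ (i ℕ.+ i)))) (sym (guard-+ i n _ _)) ⟩
  H m n + guard i n (X (m - + 1) n′ + X (m + + 1) n′) - guard (i ℕ.+ i) n (X m (n ∸ (i ℕ.+ i))) ∎
  where
  open ≡-Reasoning
  X = divide i H
  n′ = n ∸ i
  rearrange : ∀ h a b c → h + (b - c) + a ≡ h + (a + b) - c
  rearrange = solve-∀

module _ {i : ℕ} where
  open ≡-Reasoning

  isQuotient-unique : ∀ .{{_ : NonZero i}} {H X Y} → IsQuotient i H X → IsQuotient i H Y → ∀ m n → X m n ≡ Y m n
  isQuotient-unique {H} {X} {Y} rX rY m n = <-rec (λ n → ∀ m → X m n ≡ Y m n) agree n m
    where
    0<i = ℕ.>-nonZero⁻¹ i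
    agree : ∀ n → (∀ {k} → k < n → ∀ m → X m k ≡ Y m k) → ∀ m → X m n ≡ Y m n
    agree n earlier m = begin
      X m n
        ≡⟨ recurrence rX m n ⟩
      H m n + guard i n (X (m - + 1) (n ∸ i) + X (m + + 1) (n ∸ i)) - guard (i ℕ.+ i) n (X m (n ∸ (i ℕ.+ i)))
        ≡⟨ cong₂ (λ u v → H m n + u - v)
             (guard-cong i n λ i≤n → cong₂ _+_ (earlier (smaller 0<i i≤n) _) (earlier (smaller 0<i i≤n) _))
             (guard-cong (i ℕ.+ i) n λ 2i≤n → earlier (smaller (ℕP.<-≤-trans 0<i (ℕP.m≤m+n i i)) 2i≤n) m) ⟩
      H m n + guard i n (Y (m - + 1) (n ∸ i) + Y (m + + 1) (n ∸ i)) - guard (i ℕ.+ i) n (Y m (n ∸ (i ℕ.+ i)))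
        ≡⟨ sym (recurrence rY m n) ⟩
      Y m n ∎
      where
      smaller : ∀ {c} → 0 < c → c ≤ n → n ∸ c < n
      smaller = ℕP.∸-monoʳ-<

  isQuotient-congˡ : ∀ {H H′ X} → (∀ m n → H m n ≡ H′ m n) → IsQuotient i H X → IsQuotient i H′ X
  recurrence (isQuotient-congˡ H≡H′ r) m n = trans (recurrence r m n) (cong (λ h → h + _ - _) (H≡H′ m n))

  isQuotient-⊕ : ∀ {H X H′ X′} → IsQuotient i H X → IsQuotient i H′ X′ → IsQuotient i (H ⊕ H′) (X ⊕ X′)
  recurrence (isQuotient-⊕ {H} {X} {H′} {X′} r r′) m n = begin
    X m n + X′ m n
      ≡⟨ cong₂ _+_ (recurrence r m n) (recurrence r′ m n) ⟩
    (H m n + guard i n (a + b) - guard ii n c) + (H′ m n + guard i n (a′ + b′) - guard ii n c′)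
      ≡⟨ cong₂ (λ u v → (H m n + u - guard ii n c) + (H′ m n + v - guard ii n c′))
           (guard-+ i n a b) (guard-+ i n a′ b′) ⟩
    (H m n + (guard i n a + guard i n b) - guard ii n c) + (H′ m n + (guard i n a′ + guard i n b′) - guard ii n c′)
      ≡⟨ interchange (H m n) (guard i n a) (guard i n b) (guard ii n c)
                     (H′ m n) (guard i n a′) (guard i n b′) (guard ii n c′) ⟩
    (H m n + H′ m n) + ((guard i n a + guard i n a′) + (guard i n b + guard i n b′)) - (guard ii n c + guard ii n c′)
      ≡⟨ sym (cong₂ (λ u v → (H m n + H′ m n) + u - v)
           (trans (guard-+ i n _ _) (cong₂ _+_ (guard-+ i n a a′) (guard-+ i n b b′)))
           (guard-+ ii n c c′)) ⟩
    (H m n + H′ m n) + guard i n ((a + a′) + (b + b′)) - guard ii n (c + c′) ∎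
    where
    ii = i ℕ.+ i
    a = X (m - + 1) (n ∸ i)
    b = X (m + + 1) (n ∸ i)
    c = X m (n ∸ ii)
    a′ = X′ (m - + 1) (n ∸ i)
    b′ = X′ (m + + 1) (n ∸ i)
    c′ = X′ m (n ∸ ii)
    interchange : ∀ h a b c h′ a′ b′ c′ →
      (h + (a + b) - c) + (h′ + (a′ + b′) - c′) ≡ (h + h′) + ((a + a′) + (b + b′)) - (c + c′)
    interchange = solve-∀

  isQuotient-neg : ∀ {H X} → IsQuotient i H X → IsQuotient i (negₛ H) (negₛ X)
  recurrence (isQuotient-neg {H} {X} r) m n = begin
    - X m n
      ≡⟨ cong -_ (recurrence r m n) ⟩
    - (H m n + guard i n (a + b) - guard ii n c)
      ≡⟨ cong (λ u → - (H m n + u - guard ii n c)) (guard-+ i n a b) ⟩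
    - (H m n + (guard i n a + guard i n b) - guard ii n c)
      ≡⟨ distribute (H m n) (guard i n a) (guard i n b) (guard ii n c) ⟩
    - H m n + (- guard i n a + - guard i n b) - - guard ii n c
      ≡⟨ sym (cong₂ (λ u v → - H m n + u - v)
           (trans (guard-+ i n _ _) (cong₂ _+_ (guard-neg i n a) (guard-neg i n b)))
           (guard-neg ii n c)) ⟩
    - H m n + guard i n (- a + - b) - guard ii n (- c) ∎
    where
    ii = i ℕ.+ i
    a = X (m - + 1) (n ∸ i)
    b = X (m + + 1) (n ∸ i)
    c = X m (n ∸ ii)
    distribute : ∀ h a b c → - (h + (a + b) - c) ≡ - h + (- a + - b) - - c
    distribute = solve-∀

  isQuotient-⊝ : ∀ {H X H′ X′} → IsQuotient i H X → IsQuotient i H′ X′ → IsQuotient i (H ⊝ H′) (X ⊝ X′)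
  isQuotient-⊝ r r′ = isQuotient-⊕ r (isQuotient-neg r′)

  isQuotient-zShift : ∀ e {H X} → IsQuotient i H X → IsQuotient i (zShift e H) (zShift e X)
  recurrence (isQuotient-zShift e {H} {X} r) m n =
    trans (recurrence r (m - e) n)
          (cong₂ (λ k l → H (m - e) n + guard i n (X k (n ∸ i) + X l (n ∸ i))
                                      - guard (i ℕ.+ i) n (X (m - e) (n ∸ (i ℕ.+ i))))
                 (swap-sub m e) (swap-add m e))
    where
    swap-sub : ∀ m e → m - e - + 1 ≡ m - + 1 - e
    swap-sub = solve-∀
    swap-add : ∀ m e → m - e + + 1 ≡ m + + 1 - e
    swap-add = solve-∀

  isQuotient-qShift : ∀ d {H X} → IsQuotient i H X → IsQuotient i (qShift d H) (qShift d X)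
  recurrence (isQuotient-qShift d {H} {X} r) m n = begin
    guard d n (X m (n ∸ d))
      ≡⟨ cong (guard d n) (recurrence r m (n ∸ d)) ⟩
    guard d n (H m (n ∸ d) + guard i (n ∸ d) (a (n ∸ d ∸ i)) - guard ii (n ∸ d) (X m (n ∸ d ∸ ii)))
      ≡⟨ trans (guard-minus d n _ _) (cong (_- guard d n (guard ii (n ∸ d) (X m (n ∸ d ∸ ii)))) (guard-+ d n _ _)) ⟩
    qShift d H m n + guard d n (guard i (n ∸ d) (a (n ∸ d ∸ i))) - guard d n (guard ii (n ∸ d) (X m (n ∸ d ∸ ii)))
      ≡⟨ cong₂ (λ u v → qShift d H m n + u - v) (guard-comm d i n a) (guard-comm d ii n (X m)) ⟩
    qShift d H m n + guard i n (guard d (n ∸ i) (a (n ∸ i ∸ d))) - guard ii n (guard d (n ∸ ii) (X m (n ∸ ii ∸ d)))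
      ≡⟨ cong (λ u → qShift d H m n + guard i n u - guard ii n (guard d (n ∸ ii) (X m (n ∸ ii ∸ d))))
           (guard-+ d (n ∸ i) _ _) ⟩
    qShift d H m n + guard i n (qShift d X (m - + 1) (n ∸ i) + qShift d X (m + + 1) (n ∸ i))
                   - guard ii n (qShift d X m (n ∸ ii)) ∎
    where
    ii = i ℕ.+ i
    a = λ k → X (m - + 1) k + X (m + + 1) k

isQuotient-q⁰ : ∀ {j H X} → IsQuotient (suc j) H X → ∀ m → X m 0 ≡ H m 0
isQuotient-q⁰ {H = H} r m = trans (recurrence r m 0) (x+0-0 (H m 0))
  where
  x+0-0 : ∀ x → x + + 0 - + 0 ≡ x
  x+0-0 = solve-∀

isQuotient-upperBound : ∀ {i H X} → IsQuotient i H X → NonNegₛ X → X ≤ₛ H ⊕ qShift i (zz X)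
isQuotient-upperBound {i} {H} {X} r 0≤X m n =
  subst (ℤ._≤ H m n + qShift i (zz X) m n) (sym (recurrence r m n))
        (ℤP.i-j≤i _ _ {{ℤ.nonNegative (guard-nonneg (i ℕ.+ i) n (0≤X m (n ∸ (i ℕ.+ i))))}})

-- the recurrence of IsQuotient for the series w ∣ m ∣; at M = 0 both neighbours are w 1
AbsRecurrence : ℕ → (ℕ → ℕ → ℤ) → (ℕ → ℕ → ℤ) → Set
AbsRecurrence i h w = ∀ M n →
  w M n ≡ h M n + guard i n (w ∣ + M - + 1 ∣ (n ∸ i) + w (suc M) (n ∸ i)) - guard (i ℕ.+ i) n (w M (n ∸ (i ℕ.+ i)))

isQuotient-abs : ∀ {i h w} → AbsRecurrence i h w → IsQuotient i (λ m → h ∣ m ∣) (λ m → w ∣ m ∣)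
recurrence (isQuotient-abs {i} {h} {w} rec) (+ M) n =
  trans (rec M n) (cong (λ k → h M n + guard i n (w ∣ + M - + 1 ∣ (n ∸ i) + w k (n ∸ i))
                                    - guard (i ℕ.+ i) n (w M (n ∸ (i ℕ.+ i))))
                        (ℕP.+-comm 1 M))
recurrence (isQuotient-abs {i} {h} {w} rec) -[1+ M ] n =
  trans (rec (suc M) n) (cong (λ s → h (suc M) n + guard i n s - guard (i ℕ.+ i) n (w (suc M) (n ∸ (i ℕ.+ i))))
    (trans (ℤP.+-comm (w M (n ∸ i)) _)
           (cong₂ (λ k l → w k (n ∸ i) + w l (n ∸ i))
                  (cong (λ k → suc (suc k)) (sym (ℕP.+-identityʳ M))) (∣1-[1+M]∣ M))))
  where
  ∣1-[1+M]∣ : ∀ M → M ≡ ∣ -[1+ M ] + + 1 ∣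
  ∣1-[1+M]∣ zero    = refl
  ∣1-[1+M]∣ (suc M) = refl

𝟙 : Series
𝟙 = G 0

𝟙-nonneg : NonNegₛ 𝟙
𝟙-nonneg m n with isZeroℤ m | n
... | true  | zero  = +≤+ z≤n
... | true  | suc _ = +≤+ z≤n
... | false | _     = +≤+ z≤n

𝟙-vanish : ∀ m {n} → n ≢ 0 → 𝟙 m n ≡ + 0
𝟙-vanish m {zero}  n≢0 = ⊥-elim (n≢0 refl)
𝟙-vanish m {suc n} _ with isZeroℤ m
... | true  = refl
... | false = refl

-- the left side vanishes outside degrees 0 and i, where the recurrence evaluates X exactly
isQuotient-𝟙-lowerBound : ∀ {j X} → IsQuotient (suc j) 𝟙 X → NonNegₛ X → 𝟙 ⊕ qShift (suc j) (zz 𝟙) ≤ₛ X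
isQuotient-𝟙-lowerBound r 0≤X m zero = ℤP.≤-reflexive (trans (ℤP.+-identityʳ _) (sym (isQuotient-q⁰ r m)))
isQuotient-𝟙-lowerBound {j} {X} r 0≤X m (suc p) with suc p ℕ.≟ suc j
... | yes refl = ℤP.≤-reflexive (begin
  𝟙 m i + guard i i (𝟙 (m - + 1) (i ∸ i) + 𝟙 (m + + 1) (i ∸ i))
    ≡⟨ cong (λ u → 𝟙 m i + guard i i u) (sym (cong₂ _+_ (X≡𝟙 (m - + 1)) (X≡𝟙 (m + + 1)))) ⟩
  𝟙 m i + guard i i (X (m - + 1) (i ∸ i) + X (m + + 1) (i ∸ i))
    ≡⟨ sym (ℤP.+-identityʳ _) ⟩
  𝟙 m i + guard i i (X (m - + 1) (i ∸ i) + X (m + + 1) (i ∸ i)) - + 0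
    ≡⟨ cong (λ u → 𝟙 m i + guard i i (X (m - + 1) (i ∸ i) + X (m + + 1) (i ∸ i)) - u)
         (sym (guard-no (i ℕ.+ i) i _ (ℕP.<⇒≱ (ℕP.m<m+n i (ℕ.>-nonZero⁻¹ i))))) ⟩
  𝟙 m i + guard i i (X (m - + 1) (i ∸ i) + X (m + + 1) (i ∸ i)) - guard (i ℕ.+ i) i (X m (i ∸ (i ℕ.+ i)))
    ≡⟨ sym (recurrence r m i) ⟩
  X m i ∎)
  where
  open ≡-Reasoning
  i = suc j
  X≡𝟙 : ∀ k → X k (i ∸ i) ≡ 𝟙 k (i ∸ i)
  X≡𝟙 k = subst (λ t → X k t ≡ 𝟙 k t) (sym (ℕP.n∸n≡0 i)) (isQuotient-q⁰ r k)
... | no 1+p≢1+j = subst (ℤ._≤ X m (suc p)) (sym vanish) (0≤X m (suc p))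
  where
  i = suc j
  positive : i ≤ suc p → suc p ∸ i ≢ 0
  positive i≤1+p 1+p∸i≡0 = 1+p≢1+j (ℕP.≤-antisym (ℕP.m∸n≡0⇒m≤n 1+p∸i≡0) i≤1+p)
  vanish : 𝟙 m (suc p) + guard i (suc p) (𝟙 (m - + 1) (suc p ∸ i) + 𝟙 (m + + 1) (suc p ∸ i)) ≡ + 0
  vanish = cong₂ _+_ (𝟙-vanish m {suc p} λ ())
    (trans (guard-cong i (suc p) λ i≤1+p →
              cong₂ _+_ (𝟙-vanish (m - + 1) (positive i≤1+p)) (𝟙-vanish (m + + 1) (positive i≤1+p)))
           (guard-0 i (suc p)))

mulP : ℕ → Series → Series
mulP j X = X ⊝ qShift 1 X ⊕ qShift 2 X ⊕ qShift (2 ℕ.+ j) (zz X)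

P : ℕ → Series
P j = mulP j 𝟙

isQuotient-mulP : ∀ {i} j {H X} → IsQuotient i H X → IsQuotient i (mulP j H) (mulP j X)
isQuotient-mulP j r =
  isQuotient-⊕ (isQuotient-⊕ (isQuotient-⊝ r (isQuotient-qShift 1 r)) (isQuotient-qShift 2 r))
               (isQuotient-qShift (2 ℕ.+ j) (isQuotient-⊕ (isQuotient-zShift (+ 1) r) (isQuotient-zShift -[1+ 0 ] r)))

P-suc≤mulP : ∀ j → P (suc j) ≤ₛ mulP j (divide (suc j) 𝟙)
P-suc≤mulP j m n = combine-≤ 𝟙≤F qF≤ q²𝟙≤
  where
  i = suc j
  F = divide i 𝟙
  rF = divide-isQuotient i 𝟙
  0≤F = divide-nonneg i 𝟙-nonneg
  lower = isQuotient-𝟙-lowerBound rF 0≤F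
  𝟙≤F : 𝟙 m n ℤ.≤ F m n
  𝟙≤F = ℤP.≤-trans (ℤP.i≤i+j _ _ {{ℤ.nonNegative (guard-nonneg i n
           (ℤP.+-mono-≤ (𝟙-nonneg (m - + 1) (n ∸ i)) (𝟙-nonneg (m + + 1) (n ∸ i))))}})
         (lower m n)
  qF≤ : qShift 1 F m n ℤ.≤ qShift 1 𝟙 m n + qShift (suc i) (zz F) m n
  qF≤ = subst (qShift 1 F m n ℤ.≤_) (qShift-⊕-qShift 1 i 𝟙 (zz F) m n) (qShift-mono 1 (isQuotient-upperBound rF 0≤F) m n)
  q²𝟙≤ : qShift 2 𝟙 m n + qShift (2 ℕ.+ i) (zz 𝟙) m n ℤ.≤ qShift 2 F m n
  q²𝟙≤ = subst (ℤ._≤ qShift 2 F m n) (qShift-⊕-qShift 2 i 𝟙 (zz 𝟙) m n) (qShift-mono 2 lower m n)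

P-z⁰ : ∀ j n → P j (+ 0) n ≡ onePoly n
P-z⁰ j n = trans (cong (_+_ (𝟙 (+ 0) n - qShift 1 𝟙 (+ 0) n + qShift 2 𝟙 (+ 0) n)) (guard-0 (2 ℕ.+ j) n)) (expand n)
  where
  expand : ∀ n → 𝟙 (+ 0) n - qShift 1 𝟙 (+ 0) n + qShift 2 𝟙 (+ 0) n + + 0 ≡ onePoly n
  expand 0                   = refl
  expand 1                   = refl
  expand 2                   = refl
  expand (suc (suc (suc _))) = refl

-- the shape of P j m n for m ≠ 0
P-off-axis : ∀ j n x → + 0 - guard 1 n (+ 0) + guard 2 n (+ 0) + guard (2 ℕ.+ j) n x ≡ guard (2 ℕ.+ j) n x
P-off-axis j n x rewrite guard-0 1 n | guard-0 2 n = ℤP.+-identityˡ _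

fSeries : ℕ → Series
fSeries k = G k ⊝ qShift 1 (G k)

fSeries≡fCoeff : ∀ k m n → fSeries k m n ≡ fCoeff m k n
fSeries≡fCoeff k m zero    = ℤP.+-identityʳ _
fSeries≡fCoeff k m (suc n) = refl

fSeries-isQuotient : ∀ j → IsQuotient (suc j) (fSeries j) (fSeries (suc j))
fSeries-isQuotient j = isQuotient-⊝ r (isQuotient-qShift 1 r)
  where
  r = divide-isQuotient (suc j) (G j)

P≤fSeries-step : ∀ j → P j ≤ₛ fSeries j → P (suc j) ≤ₛ fSeries (suc j)
P≤fSeries-step j P≤f m n = begin
  P (suc j) m n            ≤⟨ P-suc≤mulP j m n ⟩
  mulP j (divide i 𝟙) m n  ≡⟨ isQuotient-unique (isQuotient-mulP j (divide-isQuotient i 𝟙)) (divide-isQuotient i (P j)) m n ⟩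
  divide i (P j) m n       ≤⟨ divide-mono i P≤f m n ⟩
  divide i (fSeries j) m n ≡⟨ isQuotient-unique (divide-isQuotient i (fSeries j)) (fSeries-isQuotient j) m n ⟩
  fSeries (suc j) m n      ∎
  where
  open ℤP.≤-Reasoning
  i = suc j

negOnePow : ℕ → ℤ
negOnePow 0             = + 1
negOnePow 1             = -[1+ 0 ]
negOnePow (suc (suc t)) = negOnePow t

-- coefficient of qⁿ in qᶜ / (1 + q)
altFrom : ℕ → ℕ → ℤ
altFrom c n = guard c n (negOnePow (n ∸ c))

fSeries₀-abs : ∀ m n → fSeries 0 m n ≡ fSeries 0 (+ ∣ m ∣) n
fSeries₀-abs (+ M)    n = refl
fSeries₀-abs -[1+ M ] n = refl

altFrom-recurrence : AbsRecurrence 1 (λ M → fSeries 0 (+ M)) altFrom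
altFrom-recurrence zero    zero          = refl
altFrom-recurrence zero    (suc zero)    = refl
altFrom-recurrence zero    (suc (suc p)) = x≡x+x-x (negOnePow p)
  where
  x≡x+x-x : ∀ x → x ≡ (+ 0 - + 0) + (x + x) - x
  x≡x+x-x = solve-∀
altFrom-recurrence (suc M) zero          = refl
altFrom-recurrence (suc M) (suc zero)    = trans (guard-suc M 0 _) (x≡x+0 (altFrom M 0))
  where
  x≡x+0 : ∀ x → x ≡ (+ 0 - + 0) + (x + + 0) - + 0
  x≡x+0 = solve-∀
altFrom-recurrence (suc M) (suc (suc n)) =
  trans (guard-suc M (suc n) _)
    (trans (x≡x+y-y (altFrom M (suc n)) (altFrom (suc M) n))
           (cong (λ y → (+ 0 - + 0) + (altFrom M (suc n) + y) - altFrom (suc M) n) (sym (guard-suc (suc M) n _))))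
  where
  x≡x+y-y : ∀ x y → x ≡ (+ 0 - + 0) + (x + y) - y
  x≡x+y-y = solve-∀

fSeries₁-closed : ∀ m n → fSeries 1 m n ≡ altFrom ∣ m ∣ n
fSeries₁-closed = isQuotient-unique (fSeries-isQuotient 0)
  (isQuotient-congˡ (λ m n → sym (fSeries₀-abs m n))
                    (isQuotient-abs {h = λ M → fSeries 0 (+ M)} {w = altFrom} altFrom-recurrence))

-- coefficient of qᵗ in 1 / ((1 - q³)(1 - q⁴)), the number of solutions of 3a + 4b = t
p34 : ℕ → ℕ
p34 0  = 1
p34 1  = 0
p34 2  = 0
p34 3  = 1
p34 4  = 1
p34 5  = 0
p34 6  = 1
p34 7  = 1
p34 8  = 1
p34 9  = 1
p34 10 = 1
p34 11 = 1
p34 (suc (suc (suc (suc (suc (suc (suc (suc (suc (suc (suc (suc t)))))))))))) = suc (p34 t)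

-- coefficient of qⁿ in qᶜ / ((1 - q³)(1 - q⁴))
u : ℕ → ℕ → ℤ
u c n = guard c n (+ p34 (n ∸ c))

guard-u : ∀ d c n → guard d n (u c (n ∸ d)) ≡ u (d ℕ.+ c) n
guard-u d c n = trans (guard-guard d c n _) (cong (λ k → guard (d ℕ.+ c) n (+ p34 k)) (ℕP.∸-+-assoc n d c))

u-nonneg : ∀ c n → + 0 ℤ.≤ u c n
u-nonneg c n = guard-nonneg c n (+≤+ z≤n)

ShiftMonotone : ℕ → Set
ShiftMonotone s = ∀ t → p34 t ≤ p34 (s ℕ.+ t)

p34-shiftMonotone-3 : ShiftMonotone 3
p34-shiftMonotone-3 = periodicInduction 12 (byComputation (λ t → p34 t ℕ.≤? p34 (3 ℕ.+ t)) _) (λ _ → s≤s)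

p34-shiftMonotone-4 : ShiftMonotone 4
p34-shiftMonotone-4 = periodicInduction 12 (byComputation (λ t → p34 t ℕ.≤? p34 (4 ℕ.+ t)) _) (λ _ → s≤s)

shiftMonotone-+ : ∀ {s s′} → ShiftMonotone s → ShiftMonotone s′ → ShiftMonotone (s ℕ.+ s′)
shiftMonotone-+ {s} {s′} mono mono′ t =
  ℕP.≤-trans (mono′ t) (subst (λ k → p34 (s′ ℕ.+ t) ≤ p34 k) (sym (ℕP.+-assoc s s′ t)) (mono (s′ ℕ.+ t)))

p34-shiftMonotone-6+ : ∀ e → ShiftMonotone (6 ℕ.+ e)
p34-shiftMonotone-6+ 0                   = shiftMonotone-+ p34-shiftMonotone-3 p34-shiftMonotone-3
p34-shiftMonotone-6+ 1                   = shiftMonotone-+ p34-shiftMonotone-3 p34-shiftMonotone-4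
p34-shiftMonotone-6+ 2                   = shiftMonotone-+ p34-shiftMonotone-4 p34-shiftMonotone-4
p34-shiftMonotone-6+ (suc (suc (suc e))) = shiftMonotone-+ p34-shiftMonotone-3 (p34-shiftMonotone-6+ e)

u-antitone : ∀ {s} → ShiftMonotone s → ∀ c n → u (s ℕ.+ c) n ℤ.≤ u c n
u-antitone {s} mono c n with s ℕ.+ c ≤? n
... | no  s+c≰n = subst (ℤ._≤ u c n) (sym (guard-no (s ℕ.+ c) n _ s+c≰n)) (u-nonneg c n)
... | yes s+c≤n = subst₂ ℤ._≤_ (sym (guard-yes (s ℕ.+ c) n _ s+c≤n)) (sym (guard-yes c n _ c≤n))
                         (+≤+ (subst (λ k → p34 (n ∸ (s ℕ.+ c)) ≤ p34 k) s+[n∸[s+c]]≡n∸c (mono _)))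
  where
  c≤n = ℕP.≤-trans (ℕP.m≤n+m c s) s+c≤n
  s+[n∸[s+c]]≡n∸c : s ℕ.+ (n ∸ (s ℕ.+ c)) ≡ n ∸ c
  s+[n∸[s+c]]≡n∸c = trans (cong (λ k → s ℕ.+ (n ∸ k)) (ℕP.+-comm s c))
                      (trans (cong (s ℕ.+_) (sym (ℕP.∸-+-assoc n c s)))
                             (ℕP.m+[n∸m]≡n (ℕP.m+n≤o⇒m≤o∸n s s+c≤n)))

heptad : (ℕ → ℤ) → ℤ
heptad x = x 0 - x 1 + x 2 - (x 3 + x 3) + x 4 - x 5 + x 6

heptad-cong : ∀ {x y : ℕ → ℤ} → (∀ k → x k ≡ y k) → heptad x ≡ heptad y
heptad-cong x≡y rewrite x≡y 0 | x≡y 1 | x≡y 2 | x≡y 3 | x≡y 4 | x≡y 5 | x≡y 6 = refl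

heptad-u-6+ : ∀ q → heptad (λ k → u k (6 ℕ.+ q)) ≡ negOnePow q
heptad-u-6+ = periodicInduction 12 (byComputation (λ q → heptad (λ k → u k (6 ℕ.+ q)) ℤ.≟ negOnePow q) _)
  λ q ih → trans (drop-ones (+ p34 (6 ℕ.+ q)) (+ p34 (5 ℕ.+ q)) (+ p34 (4 ℕ.+ q)) (+ p34 (3 ℕ.+ q))
                            (+ p34 (2 ℕ.+ q)) (+ p34 (1 ℕ.+ q)) (+ p34 q)) ih
  where
  drop-ones : ∀ a b c d e f g →
    (+ 1 + a) - (+ 1 + b) + (+ 1 + c) - ((+ 1 + d) + (+ 1 + d)) + (+ 1 + e) - (+ 1 + f) + (+ 1 + g)
      ≡ a - b + c - (d + d) + e - f + g
  drop-ones = solve-∀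

heptad-u : ∀ t → heptad (λ k → u k t) ≡ negOnePow t
heptad-u 0 = refl
heptad-u 1 = refl
heptad-u 2 = refl
heptad-u 3 = refl
heptad-u 4 = refl
heptad-u 5 = refl
heptad-u (suc (suc (suc (suc (suc (suc q)))))) = heptad-u-6+ q

-- since (1 + q)(1 - q + q² - 2q³ + q⁴ - q⁵ + q⁶) = (1 - q³)(1 - q⁴)
altFrom-heptad : ∀ c n → altFrom c n ≡ heptad (λ k → u (k ℕ.+ c) n)
altFrom-heptad c n with c ≤? n
... | yes c≤n = trans (guard-yes c n _ c≤n) (trans (sym (heptad-u (n ∸ c))) (heptad-cong {y = λ k → u (k ℕ.+ c) n} λ k →
      trans (sym (guard-yes c n _ c≤n)) (trans (guard-u c k n) (cong (λ e → u e n) (ℕP.+-comm c k)))))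
... | no c≰n  = trans (guard-no c n _ c≰n) (sym (heptad-cong {x = λ k → u (k ℕ.+ c) n} {y = λ _ → + 0} λ k →
      guard-no (k ℕ.+ c) n _ λ k+c≤n → c≰n (ℕP.≤-trans (ℕP.m≤n+m c k) k+c≤n)))

-- qᵈ times the coefficient of z^(±M) in f_{·,2}, whose generating functions are
-- (1 - q + q²), q and q^(M+2) + q^(M+4) - q^(2M+5) for M = 0, 1 and M + 2, over (1 - q³)(1 - q⁴)
f₂From : ℕ → ℕ → ℕ → ℤ
f₂From d 0 n = u (d ℕ.+ 0) n - u (d ℕ.+ 1) n + u (d ℕ.+ 2) n
f₂From d 1 n = u (d ℕ.+ 1) n
f₂From d (suc (suc M)) n = u (d ℕ.+ (2 ℕ.+ M)) n + u (d ℕ.+ (4 ℕ.+ M)) n - u (d ℕ.+ (5 ℕ.+ (M ℕ.+ M))) n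

f₂ : ℕ → ℕ → ℤ
f₂ = f₂From 0

guard-f₂ : ∀ d M n → guard d n (f₂ M (n ∸ d)) ≡ f₂From d M n
guard-f₂ d 0 n = trans (guard-+ d n _ _)
  (cong₂ _+_ (trans (guard-minus d n _ _) (cong₂ _-_ (guard-u d 0 n) (guard-u d 1 n))) (guard-u d 2 n))
guard-f₂ d 1 n = guard-u d 1 n
guard-f₂ d (suc (suc M)) n = trans (guard-minus d n _ _)
  (cong₂ _-_ (trans (guard-+ d n _ _) (cong₂ _+_ (guard-u d (2 ℕ.+ M) n) (guard-u d (4 ℕ.+ M) n)))
             (guard-u d (5 ℕ.+ (M ℕ.+ M)) n))

f₂-identity : ∀ M n → heptad (λ k → u (k ℕ.+ M) n) + (f₂From 2 ∣ + M - + 1 ∣ n + f₂From 2 (suc M) n) - f₂From 4 M n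
                      ≡ f₂ M n
f₂-identity 0 n = cancel (u 0 n) (u 1 n) (u 2 n) (u 3 n) (u 4 n) (u 5 n) (u 6 n)
  where
  cancel : ∀ a₀ a₁ a₂ a₃ a₄ a₅ a₆ →
    (a₀ - a₁ + a₂ - (a₃ + a₃) + a₄ - a₅ + a₆) + (a₃ + a₃) - (a₄ - a₅ + a₆) ≡ a₀ - a₁ + a₂
  cancel = solve-∀
f₂-identity 1 n = cancel (u 1 n) (u 2 n) (u 3 n) (u 4 n) (u 5 n) (u 6 n) (u 7 n)
  where
  cancel : ∀ a₁ a₂ a₃ a₄ a₅ a₆ a₇ →
    (a₁ - a₂ + a₃ - (a₄ + a₄) + a₅ - a₆ + a₇) + ((a₂ - a₃ + a₄) + (a₄ + a₆ - a₇)) - a₅ ≡ a₁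
  cancel = solve-∀
f₂-identity 2 n = cancel (u 2 n) (u 3 n) (u 4 n) (u 5 n) (u 6 n) (u 7 n) (u 8 n) (u 9 n)
  where
  cancel : ∀ a₂ a₃ a₄ a₅ a₆ a₇ a₈ a₉ →
    (a₂ - a₃ + a₄ - (a₅ + a₅) + a₆ - a₇ + a₈) + (a₃ + (a₅ + a₇ - a₉)) - (a₆ + a₈ - a₉) ≡ a₂ + a₄ - a₅
  cancel = solve-∀
-- the q^(2K+7) term of the left neighbour is that of f₂ (3 + K); the q^(2K+11) terms of the
-- right neighbour and of q⁴ f₂ (3 + K) cancel
f₂-identity (suc (suc (suc K))) n =
  trans (cong₂ (λ x y → heptad (λ k → u (k ℕ.+ c) n) + ((u (1 ℕ.+ c) n + u (3 ℕ.+ c) n - u x n)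
                                                       + (u (3 ℕ.+ c) n + u (5 ℕ.+ c) n - u y n))
                        - (u (4 ℕ.+ c) n + u (6 ℕ.+ c) n - u (4 ℕ.+ (5 ℕ.+ (suc K ℕ.+ suc K))) n))
               (cong (6 ℕ.+_) (sym (ℕP.+-suc K K))) (cong (9 ℕ.+_) (ℕP.+-suc K (suc K))))
        (cancel (u c n) (u (1 ℕ.+ c) n) (u (2 ℕ.+ c) n) (u (3 ℕ.+ c) n) (u (4 ℕ.+ c) n) (u (5 ℕ.+ c) n)
                (u (6 ℕ.+ c) n) (u (5 ℕ.+ (suc K ℕ.+ suc K)) n) (u (4 ℕ.+ (5 ℕ.+ (suc K ℕ.+ suc K))) n))
  where
  c = 3 ℕ.+ K
  cancel : ∀ a₀ a₁ a₂ a₃ a₄ a₅ a₆ x y →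
    (a₀ - a₁ + a₂ - (a₃ + a₃) + a₄ - a₅ + a₆) + ((a₁ + a₃ - x) + (a₃ + a₅ - y)) - (a₄ + a₆ - y) ≡ a₀ + a₂ - x
  cancel = solve-∀

f₂-recurrence : AbsRecurrence 2 altFrom f₂
f₂-recurrence M n = sym (begin
  altFrom M n + guard 2 n (f₂ ∣ + M - + 1 ∣ (n ∸ 2) + f₂ (suc M) (n ∸ 2)) - guard 4 n (f₂ M (n ∸ 4))
    ≡⟨ cong₂ (λ a b → a + b - guard 4 n (f₂ M (n ∸ 4))) (altFrom-heptad M n)
         (trans (guard-+ 2 n _ _) (cong₂ _+_ (guard-f₂ 2 ∣ + M - + 1 ∣ n) (guard-f₂ 2 (suc M) n))) ⟩
  heptad (λ k → u (k ℕ.+ M) n) + (f₂From 2 ∣ + M - + 1 ∣ n + f₂From 2 (suc M) n) - guard 4 n (f₂ M (n ∸ 4))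
    ≡⟨ cong (_-_ (heptad (λ k → u (k ℕ.+ M) n) + (f₂From 2 ∣ + M - + 1 ∣ n + f₂From 2 (suc M) n)))
            (guard-f₂ 4 M n) ⟩
  heptad (λ k → u (k ℕ.+ M) n) + (f₂From 2 ∣ + M - + 1 ∣ n + f₂From 2 (suc M) n) - f₂From 4 M n
    ≡⟨ f₂-identity M n ⟩
  f₂ M n ∎)
  where open ≡-Reasoning

fSeries₂-closed : ∀ m n → fSeries 2 m n ≡ f₂ ∣ m ∣ n
fSeries₂-closed = isQuotient-unique (fSeries-isQuotient 1)
  (isQuotient-congˡ (λ m n → sym (fSeries₁-closed m n)) (isQuotient-abs {h = altFrom} {w = f₂} f₂-recurrence))

f₂-nonneg : ∀ M n → + 0 ℤ.≤ f₂ (2 ℕ.+ M) n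
f₂-nonneg 0 n = 0≤x+y-z (u-antitone p34-shiftMonotone-3 2 n) (u-nonneg 4 n)
f₂-nonneg 1 n = 0≤x+y-z (u-antitone p34-shiftMonotone-4 3 n) (u-nonneg 5 n)
f₂-nonneg 2 n = 0≤x+y-z′ (u-antitone p34-shiftMonotone-3 6 n) (u-nonneg 4 n)
f₂-nonneg (suc (suc (suc K))) n =
  0≤x+y-z (subst (λ c → u c n ℤ.≤ u (5 ℕ.+ K) n) (index K) (u-antitone (p34-shiftMonotone-6+ K) (5 ℕ.+ K) n))
          (u-nonneg (7 ℕ.+ K) n)
  where
  index : ∀ K → (6 ℕ.+ K) ℕ.+ (5 ℕ.+ K) ≡ 5 ℕ.+ ((3 ℕ.+ K) ℕ.+ (3 ℕ.+ K))
  index = ℕ-Solver.solve-∀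

f₂₀-nonneg : ∀ q → + 0 ℤ.≤ f₂ 0 (2 ℕ.+ q)
f₂₀-nonneg = periodicInduction 12 (byComputation (λ q → + 0 ℤ.≤? f₂ 0 (2 ℕ.+ q)) _) λ q 0≤f →
  subst (+ 0 ℤ.≤_) (sym (drop-ones (+ p34 (2 ℕ.+ q)) (+ p34 (1 ℕ.+ q)) (+ p34 q)))
        (ℤP.≤-trans 0≤f (ℤP.i≤i+j _ (+ 1)))
  where
  drop-ones : ∀ a b c → (+ 1 + a) - (+ 1 + b) + (+ 1 + c) ≡ a - b + c + + 1
  drop-ones = solve-∀

onePoly≤f₂₀ : ∀ n → onePoly n ℤ.≤ f₂ 0 n
onePoly≤f₂₀ 0                   = ℤP.≤-refl
onePoly≤f₂₀ 1                   = ℤP.≤-refl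
onePoly≤f₂₀ 2                   = ℤP.≤-refl
onePoly≤f₂₀ (suc (suc (suc q))) = f₂₀-nonneg (suc q)

q⁴≤u₁ : ∀ n → guard 4 n (𝟙 (+ 0) (n ∸ 4)) ℤ.≤ u 1 n
q⁴≤u₁ 0 = u-nonneg 1 0
q⁴≤u₁ 1 = u-nonneg 1 1
q⁴≤u₁ 2 = u-nonneg 1 2
q⁴≤u₁ 3 = u-nonneg 1 3
q⁴≤u₁ 4 = ℤP.≤-refl
q⁴≤u₁ (suc (suc (suc (suc (suc p))))) = +≤+ z≤n

P₂≤f₂ : ∀ m n → P 2 m n ℤ.≤ f₂ ∣ m ∣ n
P₂≤f₂ (+ 0) n = subst (ℤ._≤ f₂ 0 n) (sym (P-z⁰ 2 n)) (onePoly≤f₂₀ n)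
P₂≤f₂ (+ 1) n =
  subst (ℤ._≤ u 1 n) (sym (trans (P-off-axis 2 n _) (cong (guard 4 n) (ℤP.+-identityʳ _)))) (q⁴≤u₁ n)
P₂≤f₂ -[1+ 0 ] n =
  subst (ℤ._≤ u 1 n) (sym (trans (P-off-axis 2 n _) (cong (guard 4 n) (ℤP.+-identityˡ _)))) (q⁴≤u₁ n)
P₂≤f₂ (+ suc (suc M)) n =
  subst (ℤ._≤ f₂ (2 ℕ.+ M) n) (sym (trans (P-off-axis 2 n _) (guard-0 4 n))) (f₂-nonneg M n)
P₂≤f₂ -[1+ suc M ] n =
  subst (ℤ._≤ f₂ (2 ℕ.+ M) n) (sym (trans (P-off-axis 2 n _) (guard-0 4 n))) (f₂-nonneg M n)

P≤fSeries : ∀ k → 2 ≤ k → P k ≤ₛ fSeries k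
P≤fSeries k 2≤k = subst (λ k → P k ≤ₛ fSeries k) (ℕP.m+[n∸m]≡n 2≤k) (from2 (k ∸ 2))
  where
  from2 : ∀ d → P (2 ℕ.+ d) ≤ₛ fSeries (2 ℕ.+ d)
  from2 zero    m n = subst (P 2 m n ℤ.≤_) (sym (fSeries₂-closed m n)) (P₂≤f₂ m n)
  from2 (suc d)     = P≤fSeries-step (2 ℕ.+ d) (from2 d)

corollary2p4 : (k : ℕ) → 2 ≤ k →
    Σ (ℕ → ℕ) (λ b → (n : ℕ) → fCoeff (+ 0) k n ≡ onePoly n + + b n)
corollary2p4 k 2≤k = (λ n → ∣ fCoeff (+ 0) k n - onePoly n ∣) , λ n →
  ≤⇒≡+∣-∣ (subst₂ ℤ._≤_ (P-z⁰ k n) (fSeries≡fCoeff k (+ 0) n) (P≤fSeries k 2≤k (+ 0) n))
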